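{- Let $n,r\in\mathbb N$ with $r\geq 3$ and $r$ dividing $n$. Then there exists a graph $G_1$ on $n$ vertices with $\Delta(G_1)=n/r$ and $e(G_1)=\binom{n/r+1}{2}$ such that $G_1$ does not have an equitable $n/r$-colouring.
   Context: An equitable $k$-colouring of a graph is a proper vertex colouring with $k$ colours in which any two colour classes differ in size by at most one. $\Delta(\cdot)$ is the maximum degree and $e(\cdot)$ the number of edges. -}

module Defs where

open import Data.Nat using (ℕ; zero; suc; _≤_; _⊔_; _<_; _+_)
open import Data.Bool using (Bool; true; false; if_then_else_)
open import Data.Fin using (Fin; toℕ)
open import Data.Fin.Properties using () renaming (_≟_ to _≟ᶠ_)
open import Data.List using (List; map; foldr; allFin)
open import Data.Nat.ListAction using (sum)
open import Relation.Binary.PropositionalEquality using (_≡_; _≢_)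
open import Relation.Nullary using (does)

record Graph (n : ℕ) : Set where
  field
    adj     : Fin n → Fin n → Bool
    symm    : ∀ u v → adj u v ≡ adj v u
    irrefl  : ∀ v → adj v v ≡ false

open Graph public

count : {n : ℕ} → (Fin n → Bool) → ℕ
count {n} p = sum (map (λ u → if p u then 1 else 0) (allFin n))

degree : {n : ℕ} → Graph n → Fin n → ℕ
degree G v = count (adj G v)

-- maximum degree Δ(G) (0 for the empty vertex set)
Δ : {n : ℕ} → Graph n → ℕ
Δ {n} G = foldr _⊔_ 0 (map (degree G) (allFin n))

e : {n : ℕ} → Graph n → ℕ
e {n} G = sum (map (λ u → count (λ v → if does (Data.Nat._<?_ (toℕ u) (toℕ v)) then adj G u v else false)) (allFin n))

classSize : {n k : ℕ} → (Fin n → Fin k) → Fin k → ℕ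
classSize c i = count (λ v → does (c v ≟ᶠ i))

IsProper : {n k : ℕ} → Graph n → (Fin n → Fin k) → Set
IsProper G c = ∀ u v → adj G u v ≡ true → c u ≢ c v

IsEquitableColouring : {n : ℕ} → Graph n → (k : ℕ) → (Fin n → Fin k) → Set
IsEquitableColouring G k c = IsProper G c × (∀ i j → classSize c i ≤ suc (classSize c j))
  where open import Data.Product using (_×_)

HasEquitableColouring : {n : ℕ} → Graph n → ℕ → Set
HasEquitableColouring {n} G k = Σ (Fin n → Fin k) (IsEquitableColouring G k)
  where open import Data.Product using (Σ)

-- The witness is the complete graph on n/r + 1 vertices together with n − n/r − 1
-- isolated vertices (there is room for them since r ≥ 2 and n ≥ 1).  Its maximum
-- degree is n/r and it has (n/r + 1 choose 2) edges, but its clique of size n/r + 1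
-- cannot be properly coloured with n/r colours, equitably or not, by pigeonhole.
module Submission where

open import Defs
open import Data.Nat using (ℕ; _≤_; _/_; _+_; NonZero)
open import Data.Nat.Divisibility using (_∣_)
open import Data.Nat.Combinatorics using (_C_)
open import Data.Product using (Σ; _×_)
open import Relation.Binary.PropositionalEquality using (_≡_)
open import Relation.Nullary using (¬_)

open import Data.Nat using (zero; suc; pred; _*_; _∸_; _⊓_; _<_; _<ᵇ_; z≤n; s≤s)
open import Data.Nat.Properties
open import Data.Nat.Divisibility using (divides)
open import Data.Nat.DivMod using (m*n/n≡m)
open import Data.Nat.Combinatorics using (nC1≡n; nCk+nC[k+1]≡[n+1]C[k+1])
open import Data.Nat.ListAction using (sum)
open import Data.Bool using (Bool; true; false; if_then_else_)
open import Data.Bool.Properties using (T-≡)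
open import Data.Fin using (Fin; toℕ; inject≤) renaming (zero to fzero)
open import Data.Fin.Properties using (toℕ-inject≤; pigeonhole; toℕ<n)
open import Data.List using (map; allFin; tabulate)
open import Data.List.Properties using (map-tabulate; map-cong; foldr-preservesᵇ)
open import Data.List.Relation.Unary.All using (universal)
open import Data.List.Relation.Unary.All.Properties using (map⁺)
open import Data.Product using (_,_)
open import Function using (id; _∘_)
open import Function.Bundles using (Equivalence)
open import Relation.Binary.PropositionalEquality using (refl; sym; trans; cong; cong₂; subst; module ≡-Reasoning)

ind : Bool → ℕ
ind b = if b then 1 else 0

ind≤1 : ∀ b → ind b ≤ 1
ind≤1 true  = ≤-refl
ind≤1 false = z≤n

sumBelow : (ℕ → ℕ) → ℕ → ℕ
sumBelow f zero    = 0
sumBelow f (suc n) = f 0 + sumBelow (f ∘ suc) n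

sumBelow-cong : ∀ {f g : ℕ → ℕ} n → (∀ b → f b ≡ g b) → sumBelow f n ≡ sumBelow g n
sumBelow-cong zero    _   = refl
sumBelow-cong (suc n) f≡g = cong₂ _+_ (f≡g 0) (sumBelow-cong n (f≡g ∘ suc))

sumBelow-zero : ∀ {f : ℕ → ℕ} n → (∀ b → f b ≡ 0) → sumBelow f n ≡ 0
sumBelow-zero zero    _    = refl
sumBelow-zero (suc n) f≡0 = cong₂ _+_ (f≡0 0) (sumBelow-zero n (f≡0 ∘ suc))

sum-tabulate-toℕ : ∀ n (f : ℕ → ℕ) → sum (tabulate {n = n} (f ∘ toℕ)) ≡ sumBelow f n
sum-tabulate-toℕ zero    f = refl
sum-tabulate-toℕ (suc n) f = cong (f 0 +_) (sum-tabulate-toℕ n (f ∘ suc))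

sum-map-allFin : ∀ n (f : ℕ → ℕ) → sum (map (f ∘ toℕ) (allFin n)) ≡ sumBelow f n
sum-map-allFin n f = trans (cong sum (map-tabulate {n = n} id (f ∘ toℕ))) (sum-tabulate-toℕ n f)

count-<ᵇ : ∀ m n → sumBelow (λ b → ind (b <ᵇ m)) n ≡ m ⊓ n
count-<ᵇ m       zero    = sym (⊓-zeroʳ m)
count-<ᵇ zero    (suc n) = sumBelow-zero n (λ _ → refl)
count-<ᵇ (suc m) (suc n) = cong suc (count-<ᵇ m n)

sumBelow-∸-C2 : ∀ m n → m ≤ n → sumBelow (λ a → m ∸ suc a) n ≡ m C 2
sumBelow-∸-C2 zero    n       _        = sumBelow-zero n (λ _ → refl)
sumBelow-∸-C2 (suc m) (suc n) (s≤s m≤n) = begin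
  m + sumBelow (λ a → m ∸ suc a) n ≡⟨ cong (m +_) (sumBelow-∸-C2 m n m≤n) ⟩
  m + m C 2                        ≡⟨ cong (_+ m C 2) (sym (nC1≡n m)) ⟩
  m C 1 + m C 2                    ≡⟨ nCk+nC[k+1]≡[n+1]C[k+1] m 1 ⟩
  suc m C 2                        ∎
  where open ≡-Reasoning

Δ-≡ : ∀ {n d} (G : Graph (suc n)) → (∀ v → degree G v ≤ d) → degree G fzero ≡ d → Δ G ≡ d
Δ-≡ {n} {d} G deg≤d deg0≡d = ≤-antisym Δ≤d (subst (_≤ Δ G) deg0≡d (m≤m⊔n _ _))
  where
  Δ≤d : Δ G ≤ d
  Δ≤d = foldr-preservesᵇ {P = _≤ d} ⊔-lub z≤n (map⁺ (universal deg≤d (allFin (suc n))))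

-- Adjacency of the complete graph on the vertices {0, …, m − 1}; stripping vertex 0
-- from both endpoints leaves the complete graph on {0, …, m − 2}, shifted by one.
cliqueAdj : ℕ → ℕ → ℕ → Bool
cliqueAdj m       zero    zero    = false
cliqueAdj m       zero    (suc b) = suc b <ᵇ m
cliqueAdj m       (suc a) zero    = suc a <ᵇ m
cliqueAdj zero    (suc a) (suc b) = false
cliqueAdj (suc m) (suc a) (suc b) = cliqueAdj m a b

cliqueAdj-sym : ∀ m a b → cliqueAdj m a b ≡ cliqueAdj m b a
cliqueAdj-sym m       zero    zero    = refl
cliqueAdj-sym m       zero    (suc b) = refl
cliqueAdj-sym m       (suc a) zero    = refl
cliqueAdj-sym zero    (suc a) (suc b) = refl
cliqueAdj-sym (suc m) (suc a) (suc b) = cliqueAdj-sym m a b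

cliqueAdj-irrefl : ∀ m a → cliqueAdj m a a ≡ false
cliqueAdj-irrefl m       zero    = refl
cliqueAdj-irrefl zero    (suc a) = refl
cliqueAdj-irrefl (suc m) (suc a) = cliqueAdj-irrefl m a

cliqueAdj-< : ∀ m {a b} → a < b → b < m → cliqueAdj m a b ≡ true
cliqueAdj-< m       {zero}  {suc b} _         b<m       = Equivalence.to T-≡ (<⇒<ᵇ b<m)
cliqueAdj-< (suc m) {suc a} {suc b} (s≤s a<b) (s≤s b<m) = cliqueAdj-< m a<b b<m

cliqueDegree≤ : ∀ m a n → sumBelow (ind ∘ cliqueAdj m a) n ≤ pred m
cliqueDegree≤ m             a       zero    = z≤n
cliqueDegree≤ zero          zero    (suc n) = ≤-reflexive (sumBelow-zero n (λ _ → refl))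
cliqueDegree≤ (suc m)       zero    (suc n) = subst (_≤ m) (sym (count-<ᵇ m n)) (m⊓n≤m m n)
cliqueDegree≤ zero          (suc a) (suc n) = ≤-reflexive (sumBelow-zero n (λ _ → refl))
cliqueDegree≤ (suc zero)    (suc a) (suc n) = cliqueDegree≤ zero a n
cliqueDegree≤ (suc (suc m)) (suc a) (suc n) =
  +-mono-≤ (ind≤1 (a <ᵇ suc m)) (cliqueDegree≤ (suc m) a n)

cliqueForwardDegree : ∀ m a n →
  sumBelow (λ b → ind (if a <ᵇ b then cliqueAdj m a b else false)) n ≡ (m ⊓ n) ∸ suc a
cliqueForwardDegree zero    a       zero    = refl
cliqueForwardDegree (suc m) a       zero    = refl
cliqueForwardDegree zero    zero    (suc n) = sumBelow-zero n (λ _ → refl)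
cliqueForwardDegree (suc m) zero    (suc n) = count-<ᵇ m n
cliqueForwardDegree zero    (suc a) (suc n) = sumBelow-zero n (λ b → if-const-false (a <ᵇ b))
  where
  if-const-false : ∀ x → ind (if x then false else false) ≡ 0
  if-const-false true  = refl
  if-const-false false = refl
cliqueForwardDegree (suc m) (suc a) (suc n) = cliqueForwardDegree m a n

clique : (m n : ℕ) → Graph n
clique m n = record
  { adj    = λ u v → cliqueAdj m (toℕ u) (toℕ v)
  ; symm   = λ u v → cliqueAdj-sym m (toℕ u) (toℕ v)
  ; irrefl = λ v → cliqueAdj-irrefl m (toℕ v)
  }

degree-clique : ∀ m n v → degree (clique m n) v ≡ sumBelow (ind ∘ cliqueAdj m (toℕ v)) n
degree-clique m n v = sum-map-allFin n (ind ∘ cliqueAdj m (toℕ v))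

Δ-clique : ∀ {q n} → suc q ≤ n → Δ (clique (suc q) n) ≡ q
Δ-clique {q} {suc n} (s≤s q≤n) = Δ-≡ (clique (suc q) (suc n)) degree≤q degree0≡q
  where
  degree≤q : ∀ v → degree (clique (suc q) (suc n)) v ≤ q
  degree≤q v = subst (_≤ q) (sym (degree-clique (suc q) (suc n) v))
                     (cliqueDegree≤ (suc q) (toℕ v) (suc n))
  degree0≡q : degree (clique (suc q) (suc n)) fzero ≡ q
  degree0≡q = trans (degree-clique (suc q) (suc n) fzero)
                    (trans (count-<ᵇ q n) (m≤n⇒m⊓n≡m q≤n))

e-clique : ∀ {m n} → m ≤ n → e (clique m n) ≡ m C 2
e-clique {m} {n} m≤n = begin
  e (clique m n)                          ≡⟨ cong sum (map-cong forward (allFin n)) ⟩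
  sum (map ((λ a → (m ⊓ n) ∸ suc a) ∘ toℕ) (allFin n))
                                          ≡⟨ sum-map-allFin n (λ a → (m ⊓ n) ∸ suc a) ⟩
  sumBelow (λ a → (m ⊓ n) ∸ suc a) n      ≡⟨ sumBelow-cong n (λ a → cong (_∸ suc a) (m≤n⇒m⊓n≡m m≤n)) ⟩
  sumBelow (λ a → m ∸ suc a) n            ≡⟨ sumBelow-∸-C2 m n m≤n ⟩
  m C 2                                   ∎
  where
  open ≡-Reasoning
  forward : ∀ u → count {n = n} (λ v → if toℕ u <ᵇ toℕ v then cliqueAdj m (toℕ u) (toℕ v) else false)
                ≡ (m ⊓ n) ∸ suc (toℕ u)
  forward u = trans (sum-map-allFin n (λ b → ind (if toℕ u <ᵇ b then cliqueAdj m (toℕ u) b else false)))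
                    (cliqueForwardDegree m (toℕ u) n)

clique-proper⇒≤ : ∀ {m n k} → m ≤ n → (c : Fin n → Fin k) → IsProper (clique m n) c → m ≤ k
clique-proper⇒≤ {m} {n} {k} m≤n c proper = ≮⇒≥ k≮m
  where
  embed : Fin m → Fin n
  embed i = inject≤ i m≤n
  adjacent : ∀ {i j} → toℕ i < toℕ j → cliqueAdj m (toℕ (embed i)) (toℕ (embed j)) ≡ true
  adjacent {i} {j} i<j rewrite toℕ-inject≤ i m≤n | toℕ-inject≤ j m≤n = cliqueAdj-< m i<j (toℕ<n j)
  k≮m : ¬ k < m
  k≮m k<m with i , j , i<j , cᵢ≡cⱼ ← pigeonhole k<m (c ∘ embed) =
    proper (embed i) (embed j) (adjacent i<j) cᵢ≡cⱼ

suc-≤-* : ∀ {q r} → 2 ≤ r → 1 ≤ q * r → suc q ≤ q * r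
suc-≤-* {suc q} {r} 2≤r _ = begin
  suc (suc q)    ≤⟨ s≤s (m≤n+m (suc q) q) ⟩
  suc q + suc q  ≡⟨ cong (suc q +_) (sym (+-identityʳ (suc q))) ⟩
  2 * suc q      ≤⟨ *-monoˡ-≤ (suc q) 2≤r ⟩
  r * suc q      ≡⟨ *-comm r (suc q) ⟩
  suc q * r      ∎
  where open ≤-Reasoning

proposition2p1 : (n r : ℕ) .{{_ : NonZero r}} → 3 ≤ r → r ∣ n → 1 ≤ n →
    Σ (Graph n) (λ G₁ → (Δ G₁ ≡ n / r) × (e G₁ ≡ (n / r + 1) C 2)
    × ¬ HasEquitableColouring G₁ (n / r))
proposition2p1 .(q * r) r {{r≢0}} 3≤r (divides q refl) n≥1 rewrite m*n/n≡m q r {{r≢0}} =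
  clique (suc q) (q * r) ,
  Δ-clique q<n ,
  trans (e-clique q<n) (cong (_C 2) (+-comm 1 q)) ,
  λ (c , proper , _) → 1+n≰n (clique-proper⇒≤ q<n c proper)
  where
  q<n : suc q ≤ q * r
  q<n = suc-≤-* (≤-trans (n≤1+n 2) 3≤r) n≥1
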